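{- Let $p=3$, $k=1$, and let $e\ge1$ and $l\ge0$ be integers. Then $D_{3^l+3,1}(1,x)$ is not a permutation polynomial of $\mathbb{F}_{3^e}$.
   Context: Let $p$ be an odd prime and $k$ an integer with $0\le k\le p-1$. For $n\ge 1$, $D_{n,k}(1,x)=\sum_{i=0}^{\lfloor n/2\rfloor}\frac{n-ki}{n-i}\binom{n-i}{i}(-x)^i$, where the coefficient is the integer $\binom{n-i}{i}-(k-1)\binom{n-i-1}{i-1}$ (with $\binom{m}{ -1}=0$) viewed in $\mathbb{F}_p$; $D_{0,k}(1,x)=2-k$. Equivalently $D_{1,k}=1$ and $D_{n,k}=D_{n-1,k}-xD_{n-2,k}$ for $n\ge2$. A polynomial over $\mathbb{F}_q$ is a permutation polynomial of $\mathbb{F}_q$ if it induces a bijection of $\mathbb{F}_q$. -}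

module Defs where

open import Level using (Level; _⊔_)
open import Data.Nat using (ℕ; zero; suc; _^_)
open import Data.Fin using (Fin)
open import Data.Product using (∃; _×_)
open import Relation.Nullary using (¬_)
open import Relation.Binary.PropositionalEquality as ≡ using ()
open import Algebra.Bundles using (CommutativeRing; Semiring)
import Algebra.Definitions.RawSemiring as RS
open import Function.Bundles using (Bijection)
open import Function.Definitions using (Bijective)

-- A field: a commutative ring with 0 ≠ 1 in which every nonzero element
-- has a multiplicative inverse (agda-stdlib has no Field bundle).
record IsField {c ℓ : Level} (F : CommutativeRing c ℓ) : Set (c ⊔ ℓ) where
  open CommutativeRing F
  field
    0≉1     : ¬ (0# ≈ 1#)
    inverse : ∀ x → ¬ (x ≈ 0#) → ∃ λ y → x * y ≈ 1#

HasCard : {c ℓ : Level} (F : CommutativeRing c ℓ) → ℕ → Set (c ⊔ ℓ)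
HasCard F q = Bijection (≡.setoid (Fin q)) (CommutativeRing.setoid F)

IsFiniteFieldOfOrder : {c ℓ : Level} (F : CommutativeRing c ℓ) → ℕ → Set (c ⊔ ℓ)
IsFiniteFieldOfOrder F q = IsField F × HasCard F q

-- Evaluation of the polynomial D_{n,k}(1,x) at x ∈ F, via
-- D_{0,k} = 2 - k, D_{1,k} = 1, D_{n,k} = D_{n-1,k} - x D_{n-2,k}.
-- (Integer coefficients are interpreted in F via n × 1#; when char F = p
-- this is evaluation of the F_p-polynomial.)
module _ {c ℓ : Level} (F : CommutativeRing c ℓ) where
  open CommutativeRing F
  open RS (Semiring.rawSemiring semiring) renaming (_×_ to _·1_)

  D : ℕ → ℕ → Carrier → Carrier
  D k zero x = (1# + 1#) - (k ·1 1#)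
  D k (suc zero) x = 1#
  D k (suc (suc n)) x = D k (suc n) x - (x * D k n x)

  IsPermutation : (Carrier → Carrier) → Set (c ⊔ ℓ)
  IsPermutation f = Bijective _≈_ _≈_ f

-- Write D for the sequence of functions D_{n,1}(1,x): D₀ = D₁ = 1 and
-- Dₙ₊₂ = Dₙ₊₁ - x·Dₙ.  We exhibit two distinct points of the field at which
-- D_{3^l+3} takes the same value; this holds in every commutative ring with
-- 0 ≠ 1.
--
--   * At x = 0 the recurrence collapses to Dₙ₊₂ = Dₙ₊₁, hence Dₙ(0) = 1.
--   * At x = 1 (for any k) Dₙ₊₃(1) = -Dₙ(1), so n ↦ Dₙ(1) has period 6 and
--     D_{6m}(1) = D₀(1) = 1.  For l ≥ 1, 3^l + 3 = 6m, so D(0) = D(1).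
--   * For l = 0 the index is 4, and D₄(1) = -D₁(1) = -1 = D₄(2), while
--     1 ≠ 2 because 1 + 1 = 1 forces 1 = 0.
module Submission where

open import Defs
open import Level using (Level)
open import Data.Nat using (ℕ; zero; suc; _^_; _+_; _≥_)
open import Relation.Nullary using (¬_)
open import Algebra.Bundles using (CommutativeRing)

import Data.Nat as Nat
open import Data.Product using (_,_)
open import Relation.Binary.PropositionalEquality as ≡ using (_≡_)
open import Data.Nat.Tactic.RingSolver using (solve-∀)

halfPred : ℕ → ℕ
halfPred zero    = 0
halfPred (suc l) = 3 Nat.* halfPred l + 1

3^l-odd : ∀ l → 3 ^ l ≡ 1 + 2 Nat.* halfPred l
3^l-odd zero    = ≡.refl
3^l-odd (suc l) = ≡.trans (≡.cong (3 Nat.*_) (3^l-odd l)) (step (halfPred l))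
  where
  step : ∀ h → 3 Nat.* (1 + 2 Nat.* h) ≡ 1 + 2 Nat.* (3 Nat.* h + 1)
  step = solve-∀

-- Hence 3^(l+1) + 3 = 3·(3^l + 1) is a multiple of 6.
3^suc+3-multiple-of-6 : ∀ l → 3 ^ suc l + 3 ≡ suc (halfPred l) Nat.* 6
3^suc+3-multiple-of-6 l =
  ≡.trans (≡.cong (λ m → 3 Nat.* m + 3) (3^l-odd l)) (step (halfPred l))
  where
  step : ∀ h → 3 Nat.* (1 + 2 Nat.* h) + 3 ≡ suc h Nat.* 6
  step = solve-∀

module Evaluations {c ℓ : Level} (R : CommutativeRing c ℓ) where
  open CommutativeRing R renaming (_+_ to _+ᵣ_)
  open import Algebra.Properties.Ring ring
    using (-0#≈0#; -‿involutive; -‿distribʳ-*; xyx⁻¹≈y; -‿+-comm)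
  open import Relation.Binary.Reasoning.Setoid setoid

  -- The second test point for the case l = 0.
  two : Carrier
  two = 1# +ᵣ 1#

  sub-add : ∀ a b → (a - b) +ᵣ b ≈ a
  sub-add a b = begin
    (a - b) +ᵣ b     ≈⟨ +-assoc a (- b) b ⟩
    a +ᵣ (- b +ᵣ b)  ≈⟨ +-congˡ (-‿inverseˡ b) ⟩
    a +ᵣ 0#          ≈⟨ +-identityʳ a ⟩
    a                ∎

  add-sub : ∀ a b → (a +ᵣ b) - b ≈ a
  add-sub a b = begin
    (a +ᵣ b) - b     ≈⟨ +-assoc a b (- b) ⟩
    a +ᵣ (b - b)     ≈⟨ +-congˡ (-‿inverseʳ b) ⟩
    a +ᵣ 0#          ≈⟨ +-identityʳ a ⟩
    a                ∎

  D₁-zero : ∀ x → D R 1 0 x ≈ 1#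
  D₁-zero x = trans (+-congˡ (-‿cong (+-identityʳ 1#))) (add-sub 1# 1#)

  -- At x = 0 the recurrence is Dₙ₊₂ = Dₙ₊₁, so D_{n,1}(1,0) = 1.
  D₁-at-0 : ∀ n → D R 1 n 0# ≈ 1#
  D₁-at-0 zero          = D₁-zero 0#
  D₁-at-0 (suc zero)    = refl
  D₁-at-0 (suc (suc n)) = begin
    D R 1 (suc n) 0# - 0# * D R 1 n 0#  ≈⟨ +-congˡ (-‿cong (zeroˡ _)) ⟩
    D R 1 (suc n) 0# - 0#               ≈⟨ +-congˡ -0#≈0# ⟩
    D R 1 (suc n) 0# +ᵣ 0#              ≈⟨ +-identityʳ _ ⟩
    D R 1 (suc n) 0#                    ≈⟨ D₁-at-0 (suc n) ⟩
    1#                                  ∎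

  -- At x = 1: Dₙ₊₃ = (Dₙ₊₁ - Dₙ) - Dₙ₊₁ = -Dₙ, for every k.
  D-at-1-antiperiod-3 : ∀ k n → D R k (3 + n) 1# ≈ - D R k n 1#
  D-at-1-antiperiod-3 k n = begin
    (a - 1# * b) - 1# * a  ≈⟨ +-cong (+-congˡ (-‿cong (*-identityˡ b)))
                                     (-‿cong (*-identityˡ a)) ⟩
    (a - b) - a            ≈⟨ xyx⁻¹≈y a (- b) ⟩
    - b                    ∎
    where
    a = D R k (suc n) 1#
    b = D R k n 1#

  D-at-1-period-6 : ∀ k n → D R k (6 + n) 1# ≈ D R k n 1#
  D-at-1-period-6 k n = begin
    D R k (6 + n) 1#    ≈⟨ D-at-1-antiperiod-3 k (3 + n) ⟩
    - D R k (3 + n) 1#  ≈⟨ -‿cong (D-at-1-antiperiod-3 k n) ⟩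
    - - D R k n 1#      ≈⟨ -‿involutive _ ⟩
    D R k n 1#          ∎

  D₁-at-1-multiple-of-6 : ∀ m → D R 1 (m Nat.* 6) 1# ≈ 1#
  D₁-at-1-multiple-of-6 zero    = D₁-zero 1#
  D₁-at-1-multiple-of-6 (suc m) =
    trans (D-at-1-period-6 1 (m Nat.* 6)) (D₁-at-1-multiple-of-6 m)

  D₁₄-at-1 : D R 1 4 1# ≈ - 1#
  D₁₄-at-1 = D-at-1-antiperiod-3 1 1

  D₁₂-at-2 : D R 1 2 two ≈ - 1#
  D₁₂-at-2 = begin
    1# - two * D R 1 0 two      ≈⟨ +-congˡ (-‿cong (*-congˡ (D₁-zero two))) ⟩
    1# - two * 1#               ≈⟨ +-congˡ (-‿cong (*-identityʳ two)) ⟩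
    1# - (1# +ᵣ 1#)             ≈⟨ +-congˡ (sym (-‿+-comm 1# 1#)) ⟩
    1# +ᵣ (- 1# +ᵣ - 1#)        ≈⟨ sym (+-assoc 1# (- 1#) (- 1#)) ⟩
    (1# - 1#) +ᵣ - 1#           ≈⟨ +-congʳ (-‿inverseʳ 1#) ⟩
    0# +ᵣ - 1#                  ≈⟨ +-identityˡ _ ⟩
    - 1#                        ∎

  D₁₄-at-2 : D R 1 4 two ≈ - 1#
  D₁₄-at-2 = begin
    (d₂ - two * 1#) - two * d₂  ≈⟨ +-cong (+-cong D₁₂-at-2 (-‿cong (*-identityʳ two)))
                                          (-‿cong (*-congˡ D₁₂-at-2)) ⟩
    (- 1# - two) - two * - 1#   ≈⟨ +-congˡ (-‿cong (sym (-‿distribʳ-* two 1#))) ⟩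
    (- 1# - two) - - (two * 1#) ≈⟨ +-congˡ (-‿involutive _) ⟩
    (- 1# - two) +ᵣ two * 1#    ≈⟨ +-congˡ (*-identityʳ two) ⟩
    (- 1# - two) +ᵣ two         ≈⟨ sub-add (- 1#) two ⟩
    - 1#                        ∎
    where
    d₂ = D R 1 2 two

collision⇒¬permutation : {c ℓ : Level} (F : CommutativeRing c ℓ) →
  let open CommutativeRing F in
  ∀ {f : Carrier → Carrier} {x y : Carrier} →
  ¬ x ≈ y → f x ≈ f y → ¬ IsPermutation F f
collision⇒¬permutation F x≉y fx≈fy (injective , _) = x≉y (injective fx≈fy)

mainTheorem2 : {c ℓ : Level} (e l : ℕ) → e ≥ 1 →
    (F : CommutativeRing c ℓ) → IsFiniteFieldOfOrder F (3 ^ e) →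
    ¬ IsPermutation F (D F 1 (3 ^ l + 3))
mainTheorem2 _ zero _ F (isField , _) =
  -- The index is 4, and D₄(1) = -1 = D₄(2) with 1 ≠ 2.
  collision⇒¬permutation F 1≉2 (trans D₁₄-at-1 (sym D₁₄-at-2))
  where
  open CommutativeRing F
  open Evaluations F
  open import Algebra.Properties.Ring ring using (x+x≈x⇒x≈0)
  1≉2 : ¬ 1# ≈ two
  1≉2 1≈2 = IsField.0≉1 isField (sym (x+x≈x⇒x≈0 1# (sym 1≈2)))
mainTheorem2 _ (suc l) _ F (isField , _) =
  -- The index is a multiple of 6, and Dₙ(0) = 1 = Dₙ(1) with 0 ≠ 1.
  collision⇒¬permutation F (IsField.0≉1 isField) D-at-0≈D-at-1
  where
  open CommutativeRing F using (_≈_; 0#; 1#; trans; sym)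
  open Evaluations F
  D-at-0≈D-at-1 : D F 1 (3 ^ suc l + 3) 0# ≈ D F 1 (3 ^ suc l + 3) 1#
  D-at-0≈D-at-1 rewrite 3^suc+3-multiple-of-6 l =
    trans (D₁-at-0 (m Nat.* 6)) (sym (D₁-at-1-multiple-of-6 m))
    where m = suc (halfPred l)
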